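{- Let $S_1=\mathrm{lin}\{(1,0)^T\}$, $S_2=\mathrm{lin}\{(0,1)^T\}$, $\mathcal{S}=\{S_1,S_2\}$, and let $\alpha\in\mathbb{N}$. Then there exist two instances $\mathcal{I}_1,\mathcal{I}_2$ of the double-resolution problem DR and finite sets $F_1,F_2\subset\mathbb{Z}^2$ with the following properties: (i) $F_1$ is the unique solution of $\mathcal{I}_1$; (ii) $F_2$ is the unique solution of $\mathcal{I}_2$; (iii) $\Delta_{\mathcal{S}}(F_1,F_2)=4$; (iv) $|F_1|=|F_2|\ge\alpha$; (v) $|F_1\cap F_2|=\tfrac12|F_1|$.
   Context: For a finite set $F\subset\mathbb{Z}^2$ and a $1$-dimensional linear subspace $S$ of $\mathbb{R}^2$, the discrete X-ray $X_S F$ is the function on the set of affine lines $T$ parallel to $S$ given by $(X_S F)(T)=|F\cap T|$. For finite $F_1,F_2\subset\mathbb{Z}^2$ and a finite set $\mathcal{S}$ of such subspaces, the X-ray difference is $\Delta_{\mathcal{S}}(F_1,F_2)=\sum_{S\in\mathcal{S}}\|X_S F_1 - X_S F_2\|_1$, where $\|g\|_1=\sum_T |g(T)|$. The double-resolution problem DR: let $n_1,n_2$ be even positive integers and $B=\{0,\dots,n_1-1\}\times\{0,\dots,n_2-1\}$. An instance consists of a low-resolution gray-level image $\rho:\{0,\dots,n_1/2-1\}\times\{0,\dots,n_2/2-1\}\to\{0,1,2,3,4\}$ together with data functions $f_{S_1}, f_{S_2}$ (prescribed values on lines parallel to $S_1$ resp. $S_2$). A solution is a set $F\subset B$ (equivalently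 a binary image $\psi:B\to\{0,1\}$) such that $X_{S_1}F=f_{S_1}$, $X_{S_2}F=f_{S_2}$, and for every low-resolution pixel $y=(y_1,y_2)$ the $2\times 2$ block constraint $|F\cap(\{2y_1,2y_1+1\}\times\{2y_2,2y_2+1\})|=\rho(y)$ holds. An instance has a unique solution if it has exactly one solution. -}

module Defs where

open import Data.Nat using (ℕ; zero; suc; _+_; _*_; _<_; _<?_; _⊔_; ∣_-_∣)
open import Data.Fin using (Fin; fromℕ<; toℕ)
open import Data.Bool using (Bool; true; false; _∧_)
open import Data.Integer using (ℤ; +_; -[1+_])
open import Data.Product using (_×_)
open import Relation.Nullary using (yes; no)
open import Relation.Binary.PropositionalEquality using (_≡_)

sumTo : ℕ → (ℕ → ℕ) → ℕ
sumTo zero    f = 0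
sumTo (suc n) f = sumTo n f + f n

b2n : Bool → ℕ
b2n true  = 1
b2n false = 0

-- A binary image ψ : B → {0,1} on the box B = {0..n₁-1} × {0..n₂-1};
-- it is identified with the finite set F = {x ∈ B | ψ x = true} ⊂ ℤ².
Image : ℕ → ℕ → Set
Image n₁ n₂ = Fin n₁ → Fin n₂ → Bool

at : ∀ {n₁ n₂} → Image n₁ n₂ → ℕ → ℕ → Bool
at {n₁} {n₂} ψ x y with x <? n₁ | y <? n₂
... | yes p | yes q = ψ (fromℕ< p) (fromℕ< q)
... | _     | _     = false

xray₁ : ∀ {n₁ n₂} → Image n₁ n₂ → ℕ → ℕ
xray₁ {n₁} ψ c = sumTo n₁ (λ x → b2n (at ψ x c))

xray₂ : ∀ {n₁ n₂} → Image n₁ n₂ → ℕ → ℕ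
xray₂ {n₁} {n₂} ψ c = sumTo n₂ (λ y → b2n (at ψ c y))

-- the same X-rays on all lattice lines, indexed by c ∈ ℤ
-- (lines with c < 0 miss the box, so the X-ray vanishes there)
xray₁ℤ : ∀ {n₁ n₂} → Image n₁ n₂ → ℤ → ℕ
xray₁ℤ ψ (+ c)    = xray₁ ψ c
xray₁ℤ ψ -[1+ c ] = 0

xray₂ℤ : ∀ {n₁ n₂} → Image n₁ n₂ → ℤ → ℕ
xray₂ℤ ψ (+ c)    = xray₂ ψ c
xray₂ℤ ψ -[1+ c ] = 0

card : ∀ {n₁ n₂} → Image n₁ n₂ → ℕ
card {n₁} {n₂} ψ = sumTo n₁ (λ x → sumTo n₂ (λ y → b2n (at ψ x y)))

interCard : ∀ {n₁ n₂ m₁ m₂} → Image n₁ n₂ → Image m₁ m₂ → ℕ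
interCard {n₁} {n₂} {m₁} {m₂} ψ φ =
  sumTo (n₁ ⊔ m₁) (λ x → sumTo (n₂ ⊔ m₂) (λ y → b2n (at ψ x y ∧ at φ x y)))

-- Only lines with 0 ≤ c < max of the box sizes can meet F₁ ∪ F₂; all
-- other lines contribute 0 to the ℓ¹-norms.
Δ : ∀ {n₁ n₂ m₁ m₂} → Image n₁ n₂ → Image m₁ m₂ → ℕ
Δ {n₁} {n₂} {m₁} {m₂} ψ φ =
  sumTo (n₂ ⊔ m₂) (λ c → ∣ xray₁ ψ c - xray₁ φ c ∣)
  + sumTo (n₁ ⊔ m₁) (λ c → ∣ xray₂ ψ c - xray₂ φ c ∣)

-- The box has size n₁ × n₂ with n₁ = 2 h₁, n₂ = 2 h₂, h₁, h₂ ≥ 1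
-- (i.e. n₁, n₂ even positive).  ρ is the low-resolution gray-level image
-- with values in {0,…,4}; fS₁, fS₂ are the prescribed data functions on
-- the lines parallel to S₁ (line {x₂ = c}) resp. S₂ (line {x₁ = c}), c ∈ ℤ.
record DRInstance : Set where
  field
    h₁   : ℕ
    h₂   : ℕ
    h₁>0 : 0 < h₁
    h₂>0 : 0 < h₂
    ρ    : Fin h₁ → Fin h₂ → Fin 5
    fS₁  : ℤ → ℕ
    fS₂  : ℤ → ℕ

  n₁ : ℕ
  n₁ = 2 * h₁

  n₂ : ℕ
  n₂ = 2 * h₂

open DRInstance public

IsSolution : (I : DRInstance) → Image (n₁ I) (n₂ I) → Set
IsSolution I ψ =
  (∀ (c : ℤ) → xray₁ℤ ψ c ≡ fS₁ I c)
  × (∀ (c : ℤ) → xray₂ℤ ψ c ≡ fS₂ I c)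
  × (∀ (y₁ : Fin (h₁ I)) (y₂ : Fin (h₂ I)) →
       b2n (at ψ (2 * toℕ y₁) (2 * toℕ y₂))
       + b2n (at ψ (2 * toℕ y₁ + 1) (2 * toℕ y₂))
       + b2n (at ψ (2 * toℕ y₁) (2 * toℕ y₂ + 1))
       + b2n (at ψ (2 * toℕ y₁ + 1) (2 * toℕ y₂ + 1))
       ≡ toℕ (ρ I y₁ y₂))

IsUniqueSolution : (I : DRInstance) → Image (n₁ I) (n₂ I) → Set
IsUniqueSolution I ψ =
  IsSolution I ψ
  × (∀ (φ : Image (n₁ I) (n₂ I)) → IsSolution I φ →
       ∀ x y → φ x y ≡ ψ x y)

-- F₁ and F₂ are drawn with 2 × 2 blocks in a 10 × (4 + 4m) box.  A switching
-- component of full blocks (columns 0 and 1 over alternating bands of rows)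
-- contributes 8m pixels in which the images differ without changing any X-ray,
-- a full column common to both contributes 8m shared pixels, and two one-pixel
-- gadget blocks add one differing and one shared pixel; the differing gadget
-- pixels lie diagonally in their block, which makes Δ = 4.  Every block sum is
-- 0, 1 or 4, and each one-pixel block sees its other row and column empty in
-- the X-ray data, so the block constraints leave only one solution.
module Submission where

open import Defs
open import Data.Nat using (ℕ; zero; suc; _+_; _*_; _≤_; _<_; _<?_; _⊔_; ∣_-_∣; ⌊_/2⌋; z≤n; s≤s)
open import Data.Nat.Properties
open import Data.Nat.Tactic.RingSolver using (solve-∀)
open import Data.Fin using (Fin; fromℕ<; toℕ; #_)
open import Data.Fin.Properties using (toℕ-fromℕ<; fromℕ<-toℕ; toℕ<n)
open import Data.Bool using (Bool; true; false; not; _∧_; _xor_)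
open import Data.Bool.Properties using (¬-not)
import Data.Integer as ℤ
open import Data.Product using (Σ; _×_; _,_; proj₁; proj₂)
open import Data.Sum using (inj₁; inj₂)
open import Data.Unit using (⊤; tt)
open import Data.Empty using (⊥-elim)
open import Relation.Nullary using (yes; no)
open import Relation.Nullary.Decidable using (isYes; from-yes)
open import Relation.Binary.PropositionalEquality
  using (_≡_; refl; sym; trans; cong; cong₂; subst; subst₂; module ≡-Reasoning)

open ≡-Reasoning

sumTo-cong : ∀ n {f g : ℕ → ℕ} → (∀ {k} → k < n → f k ≡ g k) → sumTo n f ≡ sumTo n g
sumTo-cong zero    f≗g = refl
sumTo-cong (suc n) f≗g = cong₂ _+_ (sumTo-cong n (λ k<n → f≗g (m<n⇒m<1+n k<n))) (f≗g ≤-refl)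

sumTo-≡0 : ∀ n (f : ℕ → ℕ) → sumTo n f ≡ 0 → ∀ {k} → k < n → f k ≡ 0
sumTo-≡0 (suc n) f Σ≡0 k<1+n with m<1+n⇒m<n∨m≡n k<1+n
... | inj₁ k<n  = sumTo-≡0 n f (m+n≡0⇒m≡0 (sumTo n f) Σ≡0) k<n
... | inj₂ refl = m+n≡0⇒n≡0 (sumTo n f) Σ≡0

sumTo-const : ∀ n c → sumTo n (λ _ → c) ≡ n * c
sumTo-const zero    c = refl
sumTo-const (suc n) c = trans (cong (_+ c) (sumTo-const n c)) (+-comm (n * c) c)

sumTo-suc : ∀ n (f : ℕ → ℕ) → sumTo (suc n) f ≡ f 0 + sumTo n (λ k → f (suc k))
sumTo-suc zero    f = sym (+-identityʳ (f 0))
sumTo-suc (suc n) f = begin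
  sumTo (suc n) f + f (suc n)                      ≡⟨ cong (_+ f (suc n)) (sumTo-suc n f) ⟩
  f 0 + sumTo n (λ k → f (suc k)) + f (suc n)      ≡⟨ +-assoc (f 0) _ _ ⟩
  f 0 + (sumTo n (λ k → f (suc k)) + f (suc n))    ∎

sumTo-linear : ∀ n m (f g : ℕ → ℕ) →
               sumTo n (λ x → m * f x + g x) ≡ m * sumTo n f + sumTo n g
sumTo-linear zero    m f g = cong (_+ 0) (sym (*-zeroʳ m))
sumTo-linear (suc n) m f g =
  trans (cong (_+ (m * f n + g n)) (sumTo-linear n m f g)) (regroup m (sumTo n f) (sumTo n g) (f n) (g n))
  where
  regroup : ∀ m a b c d → m * a + b + (m * c + d) ≡ m * (a + c) + (b + d)
  regroup = solve-∀

par : ℕ → Bool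
par zero          = false
par (suc zero)    = true
par (suc (suc n)) = par n

-- The odd case is 2 * a + 1 rather than suc (2 * a) so that blockSum below is
-- definitionally the block constraint of IsSolution.
pos : ℕ → Bool → ℕ
pos a false = 2 * a
pos a true  = 2 * a + 1

pos-suc : ∀ a r → pos (suc a) r ≡ suc (suc (pos a r))
pos-suc a false = *-suc 2 a
pos-suc a true  = cong (_+ 1) (*-suc 2 a)

half-pos : ∀ a r → ⌊ pos a r /2⌋ ≡ a
half-pos zero    false = refl
half-pos zero    true  = refl
half-pos (suc a) r     = trans (cong ⌊_/2⌋ (pos-suc a r)) (cong suc (half-pos a r))

par-pos : ∀ a r → par (pos a r) ≡ r
par-pos zero    false = refl
par-pos zero    true  = refl
par-pos (suc a) r     = trans (cong par (pos-suc a r)) (par-pos a r)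

pos-half : ∀ i → pos ⌊ i /2⌋ (par i) ≡ i
pos-half zero          = refl
pos-half (suc zero)    = refl
pos-half (suc (suc i)) = trans (pos-suc ⌊ i /2⌋ (par i)) (cong (λ j → suc (suc j)) (pos-half i))

pos-< : ∀ {a h} r → a < h → pos a r < 2 * h
pos-< {a} {h} false a<h = *-monoʳ-< 2 a<h
pos-< {a} {h} true  a<h =
  subst (_≤ 2 * h) (trans (*-suc 2 a) (cong suc (+-comm 1 (2 * a)))) (*-monoʳ-≤ 2 a<h)

half-< : ∀ {i h} → i < 2 * h → ⌊ i /2⌋ < h
half-< {i} {h} i<2h =
  subst (⌊ suc (suc i) /2⌋ ≤_) (half-pos h true)
        (⌊n/2⌋-mono (≤-trans (s≤s i<2h) (≤-reflexive (+-comm 1 (2 * h)))))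

pairSum : (Bool → ℕ) → ℕ
pairSum f = f false + f true

sumTo-halves : ∀ h (G : ℕ → Bool → ℕ) →
               sumTo (2 * h) (λ y → G ⌊ y /2⌋ (par y)) ≡ sumTo h (λ b → pairSum (G b))
sumTo-halves zero    G = refl
sumTo-halves (suc h) G = begin
  sumTo (2 * suc h) F                       ≡⟨ cong (λ n → sumTo n F) (*-suc 2 h) ⟩
  sumTo (2 * h) F + F (2 * h) + F (suc (2 * h))
                                            ≡⟨ +-assoc (sumTo (2 * h) F) _ _ ⟩
  sumTo (2 * h) F + (F (pos h false) + F (suc (2 * h)))
                                            ≡⟨ cong₂ (λ p q → p + (F (pos h false) + q))
                                                     (sumTo-halves h G) (cong F (+-comm 1 (2 * h))) ⟩
  sumTo h (λ b → pairSum (G b)) + pairSum (λ r → F (pos h r))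
                                            ≡⟨ cong (sumTo h (λ b → pairSum (G b)) +_)
                                                     (cong₂ _+_ (F-pos false) (F-pos true)) ⟩
  sumTo h (λ b → pairSum (G b)) + pairSum (G h) ∎
  where
  F : ℕ → ℕ
  F y = G ⌊ y /2⌋ (par y)
  F-pos : ∀ r → F (pos h r) ≡ G h r
  F-pos r = cong₂ G (half-pos h r) (par-pos h r)

b2n≤1 : ∀ b → b2n b ≤ 1
b2n≤1 false = z≤n
b2n≤1 true  = ≤-refl

b2n≡0⇒false : ∀ {b} → b2n b ≡ 0 → b ≡ false
b2n≡0⇒false {false} _ = refl

b2n≡1⇒true : ∀ {b} → b2n b ≡ 1 → b ≡ true
b2n≡1⇒true {true} _ = refl

pairSum-≡0 : ∀ f → pairSum f ≡ 0 → ∀ b → f b ≡ 0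
pairSum-≡0 f Σ≡0 false = m+n≡0⇒m≡0 (f false) Σ≡0
pairSum-≡0 f Σ≡0 true  = m+n≡0⇒n≡0 (f false) Σ≡0

pairSum-≡max : ∀ k f → (∀ b → f b ≤ k) → pairSum f ≡ k + k → ∀ b → f b ≡ k
pairSum-≡max k f f≤k Σ≡2k false =
  ≤-antisym (f≤k false)
            (+-cancelʳ-≤ k k (f false) (subst (_≤ f false + k) Σ≡2k (+-monoʳ-≤ (f false) (f≤k true))))
pairSum-≡max k f f≤k Σ≡2k true =
  ≤-antisym (f≤k true)
            (+-cancelˡ-≤ k k (f true) (subst (_≤ k + f true) Σ≡2k (+-monoˡ-≤ (f true) (f≤k false))))

pairSum-≡other : ∀ b f → f (not b) ≡ 0 → pairSum f ≡ f b
pairSum-≡other false f f-true≡0  = trans (cong (f false +_) f-true≡0) (+-identityʳ (f false))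
pairSum-≡other true  f f-false≡0 = cong (_+ f true) f-false≡0

blockSum : (Bool → Bool → Bool) → ℕ
blockSum g = b2n (g false false) + b2n (g true false) + b2n (g false true) + b2n (g true true)

blockRow : (Bool → Bool → Bool) → Bool → ℕ
blockRow g s = pairSum (λ r → b2n (g r s))

blockSum-pairs : ∀ g → blockSum g ≡ pairSum (blockRow g)
blockSum-pairs g = +-assoc (b2n (g false false) + b2n (g true false)) _ _

blockSum-cong : ∀ {g h} → (∀ r s → g r s ≡ h r s) → blockSum g ≡ blockSum h
blockSum-cong g≗h =
  cong₂ _+_ (cong₂ _+_ (cong₂ _+_ (cong b2n (g≗h false false)) (cong b2n (g≗h true false)))
                       (cong b2n (g≗h false true)))
            (cong b2n (g≗h true true))

data Block : Set where
  filled : Bool → Block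
  single : Bool → Bool → Block

pixel : Block → Bool → Bool → Bool
pixel (filled b)     r s = b
pixel (single r₀ s₀) r s = isYes (r Data.Bool.≟ r₀) ∧ isYes (s Data.Bool.≟ s₀)

weight : Block → Fin 5
weight (filled false) = # 0
weight (filled true)  = # 4
weight (single _ _)   = # 1

blockSum-pixel : ∀ B → blockSum (pixel B) ≡ toℕ (weight B)
blockSum-pixel (filled false)       = refl
blockSum-pixel (filled true)        = refl
blockSum-pixel (single false false) = refl
blockSum-pixel (single false true)  = refl
blockSum-pixel (single true  false) = refl
blockSum-pixel (single true  true)  = refl

Clear : Block → (Bool → Bool → Bool) → Set
Clear (filled _)     g = ⊤
Clear (single r₀ s₀) g = (∀ s → g (not r₀) s ≡ false) × (∀ r → g r (not s₀) ≡ false)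

blockSum-forces-pixels : ∀ B g → blockSum g ≡ toℕ (weight B) → Clear B g →
                         ∀ r s → g r s ≡ pixel B r s
blockSum-forces-pixels (filled false) g Σ≡0 _ r s =
  b2n≡0⇒false (pairSum-≡0 (λ r → b2n (g r s))
                 (pairSum-≡0 (blockRow g) (trans (sym (blockSum-pairs g)) Σ≡0) s) r)
blockSum-forces-pixels (filled true) g Σ≡4 _ r s =
  b2n≡1⇒true (pairSum-≡max 1 (λ r → b2n (g r s)) (λ r → b2n≤1 (g r s))
               (pairSum-≡max 2 (blockRow g) blockRow≤2 (trans (sym (blockSum-pairs g)) Σ≡4) s) r)
  where
  blockRow≤2 : ∀ s → blockRow g s ≤ 2
  blockRow≤2 s = +-mono-≤ (b2n≤1 (g false s)) (b2n≤1 (g true s))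
blockSum-forces-pixels (single r₀ s₀) g Σ≡1 (col , row) r s with r Data.Bool.≟ r₀ | s Data.Bool.≟ s₀
... | no r≢r₀  | _        = subst (λ r → g r s ≡ false) (sym (¬-not r≢r₀)) (col s)
... | yes refl | no s≢s₀ = subst (λ s → g r s ≡ false) (sym (¬-not s≢s₀)) (row r)
... | yes refl | yes refl = b2n≡1⇒true (trans (sym Σ≡b2n) Σ≡1)
  where
  Σ≡b2n : blockSum g ≡ b2n (g r s)
  Σ≡b2n = begin
    blockSum g                   ≡⟨ blockSum-pairs g ⟩
    pairSum (blockRow g)         ≡⟨ cong₂ _+_ (inner false) (inner true) ⟩
    pairSum (λ s → b2n (g r s))  ≡⟨ pairSum-≡other s (λ s → b2n (g r s)) (cong b2n (row r)) ⟩
    b2n (g r s)                  ∎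
    where
    inner : ∀ s → blockRow g s ≡ b2n (g r₀ s)
    inner s = pairSum-≡other r₀ (λ r → b2n (g r s)) (cong b2n (col s))

at-tabulate : ∀ {n₁ n₂} (g : ℕ → ℕ → Bool) {x y} → x < n₁ → y < n₂ →
              at {n₁} {n₂} (λ i j → g (toℕ i) (toℕ j)) x y ≡ g x y
at-tabulate {n₁} {n₂} g {x} {y} x<n₁ y<n₂ with x <? n₁ | y <? n₂
... | yes p   | yes q   = cong₂ g (toℕ-fromℕ< p) (toℕ-fromℕ< q)
... | yes _   | no y≮n₂ = ⊥-elim (y≮n₂ y<n₂)
... | no x≮n₁ | _       = ⊥-elim (x≮n₁ x<n₁)

at-toℕ : ∀ {n₁ n₂} (φ : Image n₁ n₂) x y → at φ (toℕ x) (toℕ y) ≡ φ x y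
at-toℕ {n₁} {n₂} φ x y with toℕ x <? n₁ | toℕ y <? n₂
... | yes p   | yes q   = cong₂ φ (fromℕ<-toℕ x p) (fromℕ<-toℕ y q)
... | yes _   | no y≮n₂ = ⊥-elim (y≮n₂ (toℕ<n y))
... | no x≮n₁ | _       = ⊥-elim (x≮n₁ (toℕ<n x))

Isolated : DRInstance → ℕ → ℕ → Block → Set
Isolated I a b (filled _)     = ⊤
Isolated I a b (single r₀ s₀) = fS₂ I (ℤ.+ pos a (not r₀)) ≡ 0 × fS₁ I (ℤ.+ pos b (not s₀)) ≡ 0

module _ {I : DRInstance} {φ : Image (n₁ I) (n₂ I)} (sol : IsSolution I φ) where

  private
    xrays₁ = proj₁ sol
    xrays₂ = proj₁ (proj₂ sol)
    blocks = proj₂ (proj₂ sol)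

  solution-empty-row : ∀ {x y} → fS₁ I (ℤ.+ y) ≡ 0 → x < n₁ I → at φ x y ≡ false
  solution-empty-row {y = y} row≡0 x<n₁ =
    b2n≡0⇒false (sumTo-≡0 (n₁ I) (λ x → b2n (at φ x y)) (trans (xrays₁ (ℤ.+ y)) row≡0) x<n₁)

  solution-empty-column : ∀ {x y} → fS₂ I (ℤ.+ x) ≡ 0 → y < n₂ I → at φ x y ≡ false
  solution-empty-column {x} col≡0 y<n₂ =
    b2n≡0⇒false (sumTo-≡0 (n₂ I) (λ y → b2n (at φ x y)) (trans (xrays₂ (ℤ.+ x)) col≡0) y<n₂)

  solution-determined : (blk : ℕ → ℕ → Block) →
                        (∀ y₁ y₂ → ρ I y₁ y₂ ≡ weight (blk (toℕ y₁) (toℕ y₂))) →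
                        (∀ a b → Isolated I a b (blk a b)) →
                        ∀ {x y} → x < n₁ I → y < n₂ I →
                        at φ x y ≡ pixel (blk ⌊ x /2⌋ ⌊ y /2⌋) (par x) (par y)
  solution-determined blk ρ≡weight isolated {x} {y} x<n₁ y<n₂ =
    subst₂ (λ i j → at φ i j ≡ pixel (blk a b) (par x) (par y)) (pos-half x) (pos-half y)
           (blockSum-forces-pixels (blk a b) g blockSum≡weight (clear (blk a b) (isolated a b))
                                   (par x) (par y))
    where
    a = ⌊ x /2⌋
    b = ⌊ y /2⌋
    a<h₁ = half-< x<n₁
    b<h₂ = half-< y<n₂
    g : Bool → Bool → Bool
    g r s = at φ (pos a r) (pos b s)
    blockSum≡weight : blockSum g ≡ toℕ (weight (blk a b))
    blockSum≡weight =
      subst₂ (λ i j → blockSum (λ r s → at φ (pos i r) (pos j s)) ≡ toℕ (weight (blk i j)))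
             (toℕ-fromℕ< a<h₁) (toℕ-fromℕ< b<h₂)
             (trans (blocks (fromℕ< a<h₁) (fromℕ< b<h₂)) (cong toℕ (ρ≡weight _ _)))
    clear : ∀ B → Isolated I a b B → Clear B g
    clear (filled _)     _               = tt
    clear (single r₀ s₀) (col≡0 , row≡0) =
      (λ s → solution-empty-column col≡0 (pos-< s b<h₂)) ,
      (λ r → solution-empty-row row≡0 (pos-< r a<h₁))

data RowKind : Set where
  gadgetA gadgetC : RowKind
  band            : Bool → RowKind

rowKind : ℕ → RowKind
rowKind 0             = gadgetA
rowKind 1             = gadgetC
rowKind (suc (suc k)) = band (par k)

bandWeight gadgetWeight : (RowKind → Bool → ℕ) → ℕ
bandWeight   W = pairSum (λ s → pairSum (W (band s)))
gadgetWeight W = pairSum (W gadgetA) + pairSum (W gadgetC)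

sumTo-rows : ∀ m (W : RowKind → Bool → ℕ) →
             sumTo (2 * (2 + 2 * m)) (λ y → W (rowKind ⌊ y /2⌋) (par y))
             ≡ m * bandWeight W + gadgetWeight W
sumTo-rows m W = begin
  sumTo (2 * (2 + 2 * m)) (λ y → W (rowKind ⌊ y /2⌋) (par y))
    ≡⟨ sumTo-halves (2 + 2 * m) (λ b → W (rowKind b)) ⟩
  sumTo (2 + 2 * m) (λ b → pairSum (W (rowKind b)))
    ≡⟨ sumTo-suc (1 + 2 * m) _ ⟩
  pairSum (W gadgetA) + sumTo (1 + 2 * m) (λ b → pairSum (W (rowKind (suc b))))
    ≡⟨ cong (pairSum (W gadgetA) +_) (sumTo-suc (2 * m) _) ⟩
  pairSum (W gadgetA) + (pairSum (W gadgetC) + sumTo (2 * m) (λ k → pairSum (W (band (par k)))))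
    ≡⟨ cong (λ t → pairSum (W gadgetA) + (pairSum (W gadgetC) + t)) bands ⟩
  pairSum (W gadgetA) + (pairSum (W gadgetC) + m * bandWeight W)
    ≡⟨ sym (+-assoc (pairSum (W gadgetA)) _ _) ⟩
  gadgetWeight W + m * bandWeight W
    ≡⟨ +-comm (gadgetWeight W) _ ⟩
  m * bandWeight W + gadgetWeight W ∎
  where
  bands : sumTo (2 * m) (λ k → pairSum (W (band (par k)))) ≡ m * bandWeight W
  bands = trans (sumTo-halves m (λ _ s → pairSum (W (band s)))) (sumTo-const m (bandWeight W))

block : Bool → RowKind → ℕ → Block
block v (band s) 0 = filled (not (v xor s))
block v (band s) 1 = filled (v xor s)
block v (band s) 2 = filled true
block v gadgetA  3 = single v v
block v gadgetC  4 = single false false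
block v _        _ = filled false

pix : Bool → RowKind → ℕ → Bool → Bool
pix v R x s = pixel (block v R ⌊ x /2⌋) (par x) s

img : Bool → ℕ → ℕ → Bool
img v x y = pix v (rowKind ⌊ y /2⌋) x (par y)

colWeight : Bool → ℕ → RowKind → Bool → ℕ
colWeight v x R s = b2n (pix v R x s)

bandWeight-balanced : ∀ x → bandWeight (colWeight false x) ≡ bandWeight (colWeight true x)
bandWeight-balanced x = balanced ⌊ x /2⌋ (par x)
  where
  balanced : ∀ a r → bandWeight (λ R s → b2n (pixel (block false R a) r s))
                   ≡ bandWeight (λ R s → b2n (pixel (block true R a) r s))
  balanced 0                   r = refl
  balanced 1                   r = refl
  balanced 2                   r = refl
  balanced (suc (suc (suc a))) r = refl

module Construction (m : ℕ) where

  height : ℕ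
  height = 2 + 2 * m

  ψ : Bool → Image 10 (2 * height)
  ψ v x y = img v (toℕ x) (toℕ y)

  instanceOf : Bool → DRInstance
  instanceOf v = record
    { h₁ = 5 ; h₂ = height ; h₁>0 = s≤s z≤n ; h₂>0 = s≤s z≤n
    ; ρ = λ y₁ y₂ → weight (block v (rowKind (toℕ y₂)) (toℕ y₁))
    ; fS₁ = xray₁ℤ (ψ v) ; fS₂ = xray₂ℤ (ψ v) }

  at-ψ : ∀ v {x y} → x < 10 → y < 2 * height → at (ψ v) x y ≡ img v x y
  at-ψ v = at-tabulate (img v)

  xray₂-ψ : ∀ v {x} → x < 10 → xray₂ (ψ v) x ≡ m * bandWeight (colWeight v x) + gadgetWeight (colWeight v x)
  xray₂-ψ v {x} x<10 =
    trans (sumTo-cong (2 * height) (λ y< → cong b2n (at-ψ v x<10 y<))) (sumTo-rows m (colWeight v x))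

  xray₁-ψ : ∀ v {y} → y < 2 * height → xray₁ (ψ v) y ≡ sumTo 10 (λ x → b2n (img v x y))
  xray₁-ψ v y< = sumTo-cong 10 (λ x<10 → cong b2n (at-ψ v x<10 y<))

  empty-column : ∀ v {x} → x < 10 → bandWeight (colWeight v x) ≡ 0 → gadgetWeight (colWeight v x) ≡ 0 →
                 xray₂ (ψ v) x ≡ 0
  empty-column v x<10 band≡0 gadget≡0 =
    trans (xray₂-ψ v x<10) (cong₂ _+_ (trans (cong (m *_) band≡0) (*-zeroʳ m)) gadget≡0)

  ψ-solution : ∀ v → IsSolution (instanceOf v) (ψ v)
  ψ-solution v = (λ _ → refl) , (λ _ → refl) , λ y₁ y₂ →
    trans (blockSum-cong (λ r s → trans (at-ψ v (pos-< r (toℕ<n y₁)) (pos-< s (toℕ<n y₂)))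
                                        (img-pos (toℕ y₁) r (toℕ y₂) s)))
          (blockSum-pixel (block v (rowKind (toℕ y₂)) (toℕ y₁)))
    where
    img-pos : ∀ a r b s → img v (pos a r) (pos b s) ≡ pixel (block v (rowKind b) a) r s
    img-pos a r b s rewrite half-pos a r | half-pos b s | par-pos a r | par-pos b s = refl

  gadgetA-isolated : ∀ v → Isolated (instanceOf v) 3 0 (single v v)
  gadgetA-isolated false =
    empty-column false (from-yes (7 <? 10)) refl refl , xray₁-ψ false (pos-< true (from-yes (0 <? height)))
  gadgetA-isolated true  =
    empty-column true  (from-yes (6 <? 10)) refl refl , xray₁-ψ true (pos-< false (from-yes (0 <? height)))

  gadgetC-isolated : ∀ v → Isolated (instanceOf v) 4 1 (single false false)
  gadgetC-isolated v =
    empty-column v (from-yes (9 <? 10)) refl refl , xray₁-ψ v (pos-< true (from-yes (1 <? height)))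

  isolated : ∀ v a b → Isolated (instanceOf v) a b (block v (rowKind b) a)
  isolated v 3 0 = gadgetA-isolated v
  isolated v 4 1 = gadgetC-isolated v
  isolated v 0 0 = tt
  isolated v 1 0 = tt
  isolated v 2 0 = tt
  isolated v (suc (suc (suc (suc a)))) 0 = tt
  isolated v 0 1 = tt
  isolated v 1 1 = tt
  isolated v 2 1 = tt
  isolated v 3 1 = tt
  isolated v (suc (suc (suc (suc (suc a))))) 1 = tt
  isolated v 0 (suc (suc k)) = tt
  isolated v 1 (suc (suc k)) = tt
  isolated v 2 (suc (suc k)) = tt
  isolated v (suc (suc (suc a))) (suc (suc k)) = tt

  ψ-unique : ∀ v → IsUniqueSolution (instanceOf v) (ψ v)
  ψ-unique v = ψ-solution v , λ φ φ-solution x y →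
    trans (sym (at-toℕ φ x y))
          (solution-determined φ-solution (λ a b → block v (rowKind b) a) (λ _ _ → refl) (isolated v)
                               (toℕ<n x) (toℕ<n y))

  card-ψ : ∀ v → card (ψ v) ≡ m * 16 + 2
  card-ψ v = begin
    sumTo 10 (xray₂ (ψ v))
      ≡⟨ sumTo-cong 10 (xray₂-ψ v) ⟩
    sumTo 10 (λ x → m * bandWeight (colWeight v x) + gadgetWeight (colWeight v x))
      ≡⟨ sumTo-linear 10 m (λ x → bandWeight (colWeight v x)) (λ x → gadgetWeight (colWeight v x)) ⟩
    m * sumTo 10 (λ x → bandWeight (colWeight v x)) + sumTo 10 (λ x → gadgetWeight (colWeight v x))
      ≡⟨ cong₂ (λ p q → m * p + q) (bands v) (gadgets v) ⟩
    m * 16 + 2 ∎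
    where
    bands : ∀ v → sumTo 10 (λ x → bandWeight (colWeight v x)) ≡ 16
    bands false = refl
    bands true  = refl
    gadgets : ∀ v → sumTo 10 (λ x → gadgetWeight (colWeight v x)) ≡ 2
    gadgets false = refl
    gadgets true  = refl

  inter-ψ : interCard (ψ false) (ψ true) ≡ m * 8 + 1
  inter-ψ = begin
    sumTo 10 (λ x → sumTo (2 * height ⊔ 2 * height) (λ y → both (at (ψ false) x y) (at (ψ true) x y)))
      ≡⟨ cong (λ n → sumTo 10 (λ x → sumTo n (λ y → both (at (ψ false) x y) (at (ψ true) x y))))
              (⊔-idem (2 * height)) ⟩
    sumTo 10 (λ x → sumTo (2 * height) (λ y → both (at (ψ false) x y) (at (ψ true) x y)))
      ≡⟨ sumTo-cong 10 (λ {x} x<10 → trans (sumTo-cong (2 * height)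
                                         (λ y< → cong₂ both (at-ψ false x<10 y<) (at-ψ true x<10 y<)))
                                       (sumTo-rows m (W x))) ⟩
    sumTo 10 (λ x → m * bandWeight (W x) + gadgetWeight (W x))
      ≡⟨ sumTo-linear 10 m (λ x → bandWeight (W x)) (λ x → gadgetWeight (W x)) ⟩
    m * 8 + 1 ∎
    where
    both : Bool → Bool → ℕ
    both p q = b2n (p ∧ q)
    W : ℕ → RowKind → Bool → ℕ
    W x R s = both (pix false R x s) (pix true R x s)

  Δ-ψ : Δ (ψ false) (ψ true) ≡ 4
  Δ-ψ = cong₂ _+_ rows columns
    where
    W : RowKind → Bool → ℕ
    W R s = ∣ sumTo 10 (λ x → b2n (pix false R x s)) - sumTo 10 (λ x → b2n (pix true R x s)) ∣
    rows : sumTo (2 * height ⊔ 2 * height) (λ y → ∣ xray₁ (ψ false) y - xray₁ (ψ true) y ∣) ≡ 2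
    rows = begin
      sumTo (2 * height ⊔ 2 * height) (λ y → ∣ xray₁ (ψ false) y - xray₁ (ψ true) y ∣)
        ≡⟨ cong (λ n → sumTo n (λ y → ∣ xray₁ (ψ false) y - xray₁ (ψ true) y ∣)) (⊔-idem (2 * height)) ⟩
      sumTo (2 * height) (λ y → ∣ xray₁ (ψ false) y - xray₁ (ψ true) y ∣)
        ≡⟨ sumTo-cong (2 * height) (λ y< → cong₂ ∣_-_∣ (xray₁-ψ false y<) (xray₁-ψ true y<)) ⟩
      sumTo (2 * height) (λ y → W (rowKind ⌊ y /2⌋) (par y))
        ≡⟨ sumTo-rows m W ⟩
      m * 0 + 2
        ≡⟨ cong (_+ 2) (*-zeroʳ m) ⟩
      2 ∎
    columns : sumTo 10 (λ x → ∣ xray₂ (ψ false) x - xray₂ (ψ true) x ∣) ≡ 2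
    columns = sumTo-cong 10 λ {x} x<10 → begin
      ∣ xray₂ (ψ false) x - xray₂ (ψ true) x ∣
        ≡⟨ cong₂ ∣_-_∣ (xray₂-ψ false x<10)
                 (trans (xray₂-ψ true x<10)
                        (cong (λ k → m * k + gadgetWeight (colWeight true x)) (sym (bandWeight-balanced x)))) ⟩
      ∣ m * bandWeight (colWeight false x) + gadgetWeight (colWeight false x)
        - m * bandWeight (colWeight false x) + gadgetWeight (colWeight true x) ∣
        ≡⟨ ∣m+n-m+o∣≡∣n-o∣ (m * bandWeight (colWeight false x)) _ _ ⟩
      ∣ gadgetWeight (colWeight false x) - gadgetWeight (colWeight true x) ∣ ∎

theorem19 : (α : ℕ) →
    Σ DRInstance λ I₁ → Σ DRInstance λ I₂ →
    Σ (Image (n₁ I₁) (n₂ I₁)) λ F₁ → Σ (Image (n₁ I₂) (n₂ I₂)) λ F₂ →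
    IsUniqueSolution I₁ F₁
    × IsUniqueSolution I₂ F₂
    × Δ F₁ F₂ ≡ 4
    × card F₁ ≡ card F₂
    × α ≤ card F₁
    × 2 * interCard F₁ F₂ ≡ card F₁
theorem19 α =
  instanceOf false , instanceOf true , ψ false , ψ true ,
  ψ-unique false , ψ-unique true , Δ-ψ ,
  trans (card-ψ false) (sym (card-ψ true)) ,
  subst (α ≤_) (sym (card-ψ false)) (≤-trans (m≤m*n α 16) (m≤m+n (α * 16) 2)) ,
  trans (cong (2 *_) inter-ψ) (trans (double α) (sym (card-ψ false)))
  where
  open Construction α
  double : ∀ m → 2 * (m * 8 + 1) ≡ m * 16 + 2
  double = solve-∀
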